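{- Let $\mathcal{A}$ be an affine plane of order $q$ with points $p_1, \dots, p_{q^2}$ and parallel classes of lines $\mathcal{L}_1, \dots, \mathcal{L}_{q+1}$, and let $\mathcal{L}_i(j)$ denote the unique line with $p_j \in \mathcal{L}_i(j) \in \mathcal{L}_i$. Let $H = (V, E)$ be the $(q+1)$-uniform hypergraph with vertex set $V = \{v_{ij} : 1 \le i \le q+1, 1 \le j \le q^2\} \cup \{w_i : 1 \le i \le q+1\}$ and edges: $e(p_j) := \{v_{ij} : 1 \le i \le q+1\}$ for each point $p_j$; $e(l) := \{v_{ij} : l = \mathcal{L}_i(j)\} \cup \{w_i\}$ for each line $l \in \mathcal{L}_i$ and each $i$; and $e_0 := \{w_i : 1 \le i \le q+1\}$. Then $V$ can be partitioned into $q+1$ parts $V_1, \dots, V_{q+1}$ such that every edge of $H$ meets each $V_s$ in exactly one vertex if and only if there is an assignment of a permutation $\sigma_p \in \mathfrak{S}_{q+1}$ to each point $p$ of $\mathcal{A}$ such that (a) each $\sigma_p$ is a derangement ($\sigma_p(i) \neq i$ for all $i$), and (b) for any two distinct points $p, u$, if the unique line through $p$ and $u$ belongs to $\mathcal{L}_i$, then $\sigma_p(i) \neq \sigma_u(i)$.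
   Context: An affine plane of order $q$ is a 2-$(q^2, q, 1)$ design (lines are blocks of size $q$ on $q^2$ points, any two points on exactly one line); its lines split into $q+1$ parallel classes, each a partition of the point set. -}

module Defs where

open import Data.Nat using (ℕ; suc; _*_; _≤_)
open import Data.Fin using (Fin; _≟_)
open import Data.List using (List; length; filter; allFin)
open import Data.Product using (Σ; _×_; _,_)
open import Data.Sum using (_⊎_; inj₁; inj₂)
open import Data.Empty using (⊥)
open import Data.Unit using (⊤)
open import Relation.Binary.PropositionalEquality using (_≡_; _≢_)
open import Data.Fin.Permutation using (Permutation′; _⟨$⟩ʳ_)

ExactlyOne : {A : Set} → (A → Set) → Set
ExactlyOne {A} P = Σ A λ a → P a × (∀ b → P b → b ≡ a)

-- An affine plane of order q, presented as a 2-(q², q, 1) design on the points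
-- Fin (q * q) together with its labelled parallel classes Fin (suc q).
-- The lines of parallel class i are indexed by Fin q, and  line i j  is the index
-- of the line L_i(j) of class i containing point p_j (so each class is a partition
-- of the point set).  Line (i , k) is the set { j | line i j ≡ k }.
record AffinePlane (q : ℕ) : Set where
  field
    line : Fin (suc q) → Fin (q * q) → Fin q
    lineSize : ∀ i k → length (filter (λ j → line i j ≟ k) (allFin (q * q))) ≡ q
    twoPoints : ∀ j j' → j ≢ j' → ExactlyOne (λ i → line i j ≡ line i j')

module _ {q : ℕ} (A : AffinePlane q) where
  open AffinePlane A

  -- vertices: v_{ij} = inj₁ (i , j),  w_i = inj₂ i
  Vertex : Set
  Vertex = (Fin (suc q) × Fin (q * q)) ⊎ Fin (suc q)

  data Edge : Set where
    ptE : Fin (q * q) → Edge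
    lnE : Fin (suc q) → Fin q → Edge
    e₀  : Edge

  _∈E_ : Vertex → Edge → Set
  inj₁ (i , j) ∈E ptE j' = j ≡ j'
  inj₂ _       ∈E ptE _  = ⊥
  inj₁ (i' , j) ∈E lnE i k = i' ≡ i × line i j ≡ k
  inj₂ i'      ∈E lnE i k = i' ≡ i
  inj₁ _       ∈E e₀ = ⊥
  inj₂ _       ∈E e₀ = ⊤

  HasGoodPartition : Set
  HasGoodPartition =
    Σ (Vertex → Fin (suc q)) λ part →
      ∀ (e : Edge) (s : Fin (suc q)) → ExactlyOne (λ v → v ∈E e × part v ≡ s)

  HasGoodPermutations : Set
  HasGoodPermutations =
    Σ (Fin (q * q) → Permutation′ (suc q)) λ σ →
      (∀ p i → σ p ⟨$⟩ʳ i ≢ i)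
      × (∀ p u → p ≢ u → ∀ i → line i p ≡ line i u → σ p ⟨$⟩ʳ i ≢ σ u ⟨$⟩ʳ i)

{-# OPTIONS --safe #-}
module Submission where

-- Colour each vertex by the index of its part.  The edge e₀ forces the wᵢ to
-- have distinct colours, so after renaming the colours wᵢ has colour i, and the
-- edge e(p) makes i ↦ colour of v_ip a permutation σ_p.  The edge e(l) of a line
-- l of class i contains wᵢ, so no v_ip with p on l has colour i, which is (a), and
-- these v_ip have pairwise distinct colours, which is (b).  Conversely, colour
-- v_ip by σ_p(i) and wᵢ by i: by (a) and (b) the q points of a line of class i
-- carry q distinct colours other than i, so by counting they carry each of them
-- exactly once.

open import Defs
open import Data.Nat using (ℕ; suc; _*_; _≤_; _<_; s≤s)
open import Data.Nat.Properties using (<⇒≱; ≤-reflexive)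
open import Data.Fin using (Fin; zero; suc; _≟_; punchOut)
open import Data.Fin.Properties using (any?; injective⇒≤; punchOut-injective)
open import Data.Fin.Permutation
  using (Permutation′; _⟨$⟩ʳ_; _⟨$⟩ˡ_; permutation; flip; _∘ₚ_; inverseˡ; inverseʳ)
open import Data.List using (List; length; lookup; filter; allFin)
import Data.List.Relation.Unary.All as All
open import Data.List.Relation.Unary.AllPairs using (_∷_)
open import Data.List.Relation.Unary.Unique.Propositional using (Unique)
open import Data.List.Relation.Unary.Unique.Propositional.Properties using (filter⁺; allFin⁺)
open import Data.List.Membership.Propositional.Properties using (∈-lookup; ∈-filter⁻)
open import Data.Product using (∃; _×_; _,_; proj₁; proj₂; map)
open import Data.Sum using (inj₁; inj₂)
open import Data.Sum.Properties using (inj₁-injective; inj₂-injective)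
open import Data.Empty using (⊥-elim)
open import Data.Unit using (tt)
open import Function using (_∘_)
open import Function.Bundles using (_⇔_; mk⇔)
open import Function.Definitions using (Injective)
open import Relation.Nullary using (yes; no; contradiction)
open import Relation.Binary.PropositionalEquality
  using (_≡_; _≢_; refl; sym; trans; cong; module ≡-Reasoning)

ExactlyOne-unique : {A : Set} {P : A → Set} → ExactlyOne P → ∀ {a b} → P a → P b → a ≡ b
ExactlyOne-unique (_ , _ , only) pa pb = trans (only _ pa) (sym (only _ pb))

exactlyOnePreimage⇒permutation : ∀ {n} (f : Fin n → Fin n) →
  (∀ t → ExactlyOne (λ a → f a ≡ t)) → Permutation′ n
exactlyOnePreimage⇒permutation f preimage = permutation f (λ t → proj₁ (preimage t))
  (λ t → proj₁ (proj₂ (preimage t)))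
  (λ a → sym (proj₂ (proj₂ (preimage (f a))) a refl))

lookup-injective : {A : Set} {xs : List A} → Unique xs → Injective _≡_ _≡_ (lookup xs)
lookup-injective (_   ∷ _)    {zero}  {zero}  _  = refl
lookup-injective (x∉ ∷ _)    {zero}  {suc b} eq = ⊥-elim (All.lookup x∉ (∈-lookup b) eq)
lookup-injective (x∉ ∷ _)    {suc a} {zero}  eq = ⊥-elim (All.lookup x∉ (∈-lookup a) (sym eq))
lookup-injective (_   ∷ uniq) {suc a} {suc b} eq = cong suc (lookup-injective uniq eq)

injective-missing⇒< : ∀ {m n} {f : Fin m → Fin n} → Injective _≡_ _≡_ f →
  ∀ t → (∀ a → f a ≢ t) → m < n
injective-missing⇒< {n = suc _} f-inj t t∉f = s≤s (injective⇒≤ λ {a} {b} eq →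
  f-inj (punchOut-injective (t∉f a ∘ sym) (t∉f b ∘ sym) eq))

injective⇒surjective : ∀ {m n} {f : Fin m → Fin n} → Injective _≡_ _≡_ f → n ≤ m →
  ∀ t → ∃ λ a → f a ≡ t
injective⇒surjective {f = f} f-inj n≤m t with any? (λ a → f a ≟ t)
... | yes hit = hit
... | no miss =
  contradiction n≤m (<⇒≱ (injective-missing⇒< f-inj t λ a fa≡t → miss (a , fa≡t)))

injective-avoiding⇒covers : ∀ {m n} {f : Fin m → Fin (suc n)} → Injective _≡_ _≡_ f → n ≤ m →
  ∀ {i} → (∀ a → i ≢ f a) → ∀ {s} → i ≢ s → ∃ λ a → f a ≡ s
injective-avoiding⇒covers f-inj n≤m {i} i∉f i≢s
  with a , eq ← injective⇒surjective {f = λ a → punchOut (i∉f a)}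
                  (λ eq → f-inj (punchOut-injective (i∉f _) (i∉f _) eq)) n≤m (punchOut i≢s)
  = a , punchOut-injective (i∉f a) i≢s eq

module _ {q : ℕ} (A : AffinePlane q) where
  open AffinePlane A

  pointsOn : Fin (suc q) → Fin q → List (Fin (q * q))
  pointsOn i k = filter (λ j → line i j ≟ k) (allFin (q * q))

  lookup-pointsOn : ∀ i k a → line i (lookup (pointsOn i k) a) ≡ k
  lookup-pointsOn i k a =
    proj₂ (∈-filter⁻ (λ j → line i j ≟ k) {xs = allFin (q * q)} (∈-lookup a))

  lookup-pointsOn-injective : ∀ i k → Injective _≡_ _≡_ (lookup (pointsOn i k))
  lookup-pointsOn-injective i k = lookup-injective (filter⁺ _ (allFin⁺ _))

  exactlyOne-e₀ : {Q : Vertex A → Set} →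
    ExactlyOne (λ v → _∈E_ A v e₀ × Q v) → ExactlyOne (Q ∘ inj₂)
  exactlyOne-e₀ (inj₂ i , (_ , qi) , only) =
    i , qi , λ b qb → inj₂-injective (only (inj₂ b) (tt , qb))

  exactlyOne-ptE : ∀ {Q : Vertex A → Set} {p} →
    ExactlyOne (λ v → _∈E_ A v (ptE p) × Q v) → ExactlyOne (λ i → Q (inj₁ (i , p)))
  exactlyOne-ptE {p = p} (inj₁ (i , .p) , (refl , qi) , only) =
    i , qi , λ b qb → cong proj₁ (inj₁-injective (only (inj₁ (b , p)) (refl , qb)))

  module FromPartition (part : Vertex A → Fin (suc q))
    (rainbow : ∀ e s → ExactlyOne (λ v → _∈E_ A v e × part v ≡ s)) where

    τ : Permutation′ (suc q)
    τ = exactlyOnePreimage⇒permutation (part ∘ inj₂) (exactlyOne-e₀ ∘ rainbow e₀)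

    π : Fin (q * q) → Permutation′ (suc q)
    π p = exactlyOnePreimage⇒permutation (λ i → part (inj₁ (i , p)))
                                         (exactlyOne-ptE ∘ rainbow (ptE p))

    σ : Fin (q * q) → Permutation′ (suc q)
    σ p = π p ∘ₚ flip τ

    part-σ : ∀ p i → part (inj₁ (i , p)) ≡ τ ⟨$⟩ʳ (σ p ⟨$⟩ʳ i)
    part-σ p i = sym (inverseʳ τ)

    σ-derangement : ∀ p i → σ p ⟨$⟩ʳ i ≢ i
    σ-derangement p i σpi≡i
      with () ← ExactlyOne-unique (rainbow (lnE i (line i p)) (τ ⟨$⟩ʳ i))
                  ((refl , refl) , trans (part-σ p i) (cong (τ ⟨$⟩ʳ_) σpi≡i)) (refl , refl)

    σ-separated : ∀ p u → p ≢ u → ∀ i → line i p ≡ line i u → σ p ⟨$⟩ʳ i ≢ σ u ⟨$⟩ʳ i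
    σ-separated p u p≢u i same-line σpi≡σui = p≢u (cong proj₂ (inj₁-injective
      (ExactlyOne-unique (rainbow (lnE i (line i p)) (part (inj₁ (i , p))))
        ((refl , refl) , refl)
        ((refl , sym same-line) , sym same-colour))))
      where
      same-colour : part (inj₁ (i , p)) ≡ part (inj₁ (i , u))
      same-colour = begin
        part (inj₁ (i , p))          ≡⟨ part-σ p i ⟩
        τ ⟨$⟩ʳ (σ p ⟨$⟩ʳ i)          ≡⟨ cong (τ ⟨$⟩ʳ_) σpi≡σui ⟩
        τ ⟨$⟩ʳ (σ u ⟨$⟩ʳ i)          ≡⟨ sym (part-σ u i) ⟩
        part (inj₁ (i , u))          ∎
        where open ≡-Reasoning

  module FromPermutations (σ : Fin (q * q) → Permutation′ (suc q))
    (derangement : ∀ p i → σ p ⟨$⟩ʳ i ≢ i)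
    (separated : ∀ p u → p ≢ u → ∀ i → line i p ≡ line i u → σ p ⟨$⟩ʳ i ≢ σ u ⟨$⟩ʳ i) where

    part : Vertex A → Fin (suc q)
    part (inj₁ (i , p)) = σ p ⟨$⟩ʳ i
    part (inj₂ i)       = i

    σ-injective-on-line : ∀ {i p u} → line i p ≡ line i u → σ p ⟨$⟩ʳ i ≡ σ u ⟨$⟩ʳ i → p ≡ u
    σ-injective-on-line {i} {p} {u} same-line same-colour with p ≟ u
    ... | yes p≡u = p≡u
    ... | no  p≢u = contradiction same-colour (separated p u p≢u i same-line)

    line-hits-colour : ∀ i k {s} → i ≢ s → ∃ λ p → line i p ≡ k × σ p ⟨$⟩ʳ i ≡ s
    line-hits-colour i k i≢s = map point (on _ ,_)
      (injective-avoiding⇒covers colour-injective (≤-reflexive (sym (lineSize i k)))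
        (λ a → derangement (point a) i ∘ sym) i≢s)
      where
      point : Fin (length (pointsOn i k)) → Fin (q * q)
      point = lookup (pointsOn i k)
      on : ∀ a → line i (point a) ≡ k
      on = lookup-pointsOn i k
      colour-injective : Injective _≡_ _≡_ (λ a → σ (point a) ⟨$⟩ʳ i)
      colour-injective {a} {b} =
        lookup-pointsOn-injective i k ∘ σ-injective-on-line (trans (on a) (sym (on b)))

    part-rainbow : ∀ e s → ExactlyOne (λ v → _∈E_ A v e × part v ≡ s)
    part-rainbow e₀ s = inj₂ s , (tt , refl) , only
      where
      only : ∀ v → _∈E_ A v e₀ × part v ≡ s → v ≡ inj₂ s
      only (inj₂ _) (_ , refl) = refl
    part-rainbow (ptE p) s = inj₁ (σ p ⟨$⟩ˡ s , p) , (refl , inverseʳ (σ p)) , only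
      where
      only : ∀ v → _∈E_ A v (ptE p) × part v ≡ s → v ≡ inj₁ (σ p ⟨$⟩ˡ s , p)
      only (inj₁ (i , .p)) (refl , refl) = cong (λ j → inj₁ (j , p)) (sym (inverseˡ (σ p)))
    part-rainbow (lnE i k) s with i ≟ s
    ... | yes refl = inj₂ i , (refl , refl) , only
      where
      only : ∀ v → _∈E_ A v (lnE i k) × part v ≡ i → v ≡ inj₂ i
      only (inj₁ (.i , p)) ((refl , _) , σpi≡i) = contradiction σpi≡i (derangement p i)
      only (inj₂ .i)       (refl , _)           = refl
    ... | no i≢s with p , on , σpi≡s ← line-hits-colour i k i≢s
                = inj₁ (i , p) , ((refl , on) , σpi≡s) , only
      where
      only : ∀ v → _∈E_ A v (lnE i k) × part v ≡ s → v ≡ inj₁ (i , p)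
      only (inj₁ (.i , u)) ((refl , on′) , σui≡s) =
        cong (λ u → inj₁ (i , u))
             (σ-injective-on-line (trans on′ (sym on)) (trans σui≡s (sym σpi≡s)))
      only (inj₂ .i) (refl , i≡s) = contradiction i≡s i≢s

  partition⇒permutations : HasGoodPartition A → HasGoodPermutations A
  partition⇒permutations (part , rainbow) = σ , σ-derangement , σ-separated
    where open FromPartition part rainbow

  permutations⇒partition : HasGoodPermutations A → HasGoodPartition A
  permutations⇒partition (σ , derangement , separated) = part , part-rainbow
    where open FromPermutations σ derangement separated

proposition4 : (q : ℕ) → 2 ≤ q → (A : AffinePlane q) →
    HasGoodPartition A ⇔ HasGoodPermutations A
proposition4 q _ A = mk⇔ (partition⇒permutations A) (permutations⇒partition A)
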